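{- Let $A\subset\mathbb{N}^2$ and for $n\in\mathbb{N}$ let $A_n=\{m\in\mathbb{N}:(n,m)\in A\}$. Suppose that for some Følner sequence $\Phi$ in $\mathbb{N}$ one has $\limsup_{n\to\infty}\mathsf{d}_\Phi(A_n)>0$. Then there exist infinite sets $B,C\subset\mathbb{N}$ such that $\{(b,c): b\in B,\ c\in C,\ b<c\}\subset A$.
   Context: A Følner sequence in $\mathbb{N}$ is a sequence $(\Phi_N)_{N\in\mathbb{N}}$ of finite subsets of $\mathbb{N}$ with $|(\Phi_N+t)\cap\Phi_N|/|\Phi_N|\to1$ for all $t\in\mathbb{N}$. For $E\subset\mathbb{N}$, $\mathsf{d}_\Phi(E)=\lim_{N\to\infty}|E\cap\Phi_N|/|\Phi_N|$ denotes the density of $E$ along $\Phi$ (the hypothesis refers to these densities). -}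

module Defs where

open import Data.Nat using (ℕ; zero; suc; _+_; _*_; _∸_; _≤_; _<_; _≤ᵇ_; ∣_-_∣)
open import Data.Nat.Properties using (_≟_)
open import Data.Bool using (Bool; true; false; if_then_else_; _∧_; T)
open import Data.List using (List; []; _∷_; length)
open import Data.List.Relation.Unary.Unique.Propositional using (Unique)
open import Data.Product using (Σ; ∃; ∃-syntax; _×_)
open import Relation.Nullary.Decidable using (⌊_⌋)

-- Decidable subsets of ℕ are Boolean predicates; finite subsets of ℕ are
-- duplicate-free lists.

_∈ᵇ_ : ℕ → List ℕ → Bool
x ∈ᵇ [] = false
x ∈ᵇ (y ∷ ys) = if ⌊ x ≟ y ⌋ then true else (x ∈ᵇ ys)

count : (ℕ → Bool) → List ℕ → ℕ
count P [] = 0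
count P (x ∷ xs) = if P x then suc (count P xs) else count P xs

-- |(F + t) ∩ F| : y ∈ F with y ∈ F + t, i.e. t ≤ y and y - t ∈ F
shiftOverlap : List ℕ → ℕ → ℕ
shiftOverlap F t = count (λ y → (t ≤ᵇ y) ∧ ((y ∸ t) ∈ᵇ F)) F

-- Følner sequence: each Φ N a finite set, and for every t,
-- |(Φ N + t) ∩ Φ N| / |Φ N| → 1, i.e. for every k ≥ 1 eventually
-- |(Φ N + t) ∩ Φ N| / |Φ N| > 1 - 1/k  (cross-multiplied).
IsFolner : (ℕ → List ℕ) → Set
IsFolner Φ =
  ((N : ℕ) → Unique (Φ N)) ×
  ((t k : ℕ) → 1 ≤ k → ∃[ N₀ ] ((N : ℕ) → N₀ ≤ N →
      (k ∸ 1) * length (Φ N) < k * shiftOverlap (Φ N) t))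

num : (ℕ → List ℕ) → (ℕ → Bool) → ℕ → ℕ
num Φ E N = count E (Φ N)

den : (ℕ → List ℕ) → ℕ → ℕ
den Φ N = length (Φ N)

-- The density d_Φ(E) exists: the ratios |E ∩ Φ N|/|Φ N| form a Cauchy
-- sequence (cross-multiplied: k·|a_M b_M' − a_M' b_M| < b_M b_M').
DensityExists : (ℕ → List ℕ) → (ℕ → Bool) → Set
DensityExists Φ E =
  (k : ℕ) → 1 ≤ k → ∃[ N₀ ] ((M M′ : ℕ) → N₀ ≤ M → N₀ ≤ M′ →
    k * ∣ num Φ E M * den Φ M′ - num Φ E M′ * den Φ M ∣ < den Φ M * den Φ M′)

-- d_Φ(E) > p/q : there is a rational p′/q′ > p/q with the ratios
-- eventually above p′/q′.
DensityAbove : (ℕ → List ℕ) → (ℕ → Bool) → ℕ → ℕ → Set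
DensityAbove Φ E p q =
  Σ ℕ λ p′ → Σ ℕ λ q′ → 1 ≤ q′ × p * q′ < p′ * q ×
    ∃[ N₀ ] ((N : ℕ) → N₀ ≤ N → p′ * den Φ N < q′ * num Φ E N)

-- limsup_{n→∞} d_Φ(A_n) > 0 : some δ = p/q > 0 with d_Φ(A_n) > δ
-- for infinitely many n.
LimsupPositive : (ℕ → List ℕ) → (ℕ → ℕ → Bool) → Set
LimsupPositive Φ A =
  Σ ℕ λ p → Σ ℕ λ q → 1 ≤ p × 1 ≤ q ×
    ((n₀ : ℕ) → ∃[ n ] (n₀ ≤ n × DensityAbove Φ (A n) p q))

Infinite : (ℕ → Set) → Set
Infinite B = (n : ℕ) → ∃[ b ] (n ≤ b × B b)

{-# OPTIONS --safe #-}
-- Keep a finite intersection E = A_{b₀} ∩ … ∩ A_{bₖ}, infinitely many rows n and infinitely many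
-- Følner windows N along which |E ∩ A_n ∩ Φ_N| ≥ δ |Φ_N|, with δ = p/q. Among 2q² such rows,
-- double counting and Cauchy–Schwarz force two whose intersection has relative size ≥ δ²/2 in
-- the window; a Ramsey-type diagonal refinement of the windows (using excluded middle) then
-- yields a row b beyond any bound such that E ∩ A_b has the same property with δ²/2 in place of
-- δ. Positive density of E ∩ A_b and almost shift-invariance of Φ_N give c ∈ E ∩ A_b beyond b.
-- Alternating the two choices gives b₀ < c₀ < b₁ < c₁ < … with c_j ∈ A_{b_i} whenever i ≤ j.
module Submission where

open import Defs
open import Axiom.ExcludedMiddle using (ExcludedMiddle)
open import Level using (0ℓ)
open import Data.Nat
open import Data.Nat.Properties
open import Data.Nat.Tactic.RingSolver using (solve-∀)
open import Data.Bool using (Bool; true; false; _∧_; T)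
open import Data.Bool.Properties using (∧-comm; T-∧)
open import Data.List using (List; []; _∷_; length)
open import Data.List.Relation.Unary.All as All using (All; []; _∷_)
open import Data.List.Relation.Unary.AllPairs as AllPairs using (AllPairs; []; _∷_)
open import Data.Product using (Σ; ∃-syntax; _×_; _,_; proj₁; proj₂; map₂)
open import Data.Sum using (_⊎_; inj₁; inj₂)
open import Data.Empty using (⊥; ⊥-elim)
open import Data.Unit using (tt)
open import Function.Bundles using (Equivalence)
open import Relation.Nullary using (¬_; Dec; yes; no)
open import Relation.Unary using (Pred; _⊆_; _∩_; ∁; U)
open import Relation.Binary.PropositionalEquality using (_≡_; refl; sym; trans; cong; cong₂; subst; subst₂; module ≡-Reasoning)

∑ : {X : Set} → List X → (X → ℕ) → ℕ
∑ [] f = 0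
∑ (x ∷ xs) f = f x + ∑ xs f

syntax ∑ xs (λ x → e) = ∑[ x ∈ xs ] e

module _ {X : Set} where

  ∑-cong : {f g : X → ℕ} → (∀ x → f x ≡ g x) → ∀ xs → ∑ xs f ≡ ∑ xs g
  ∑-cong f≡g [] = refl
  ∑-cong f≡g (x ∷ xs) = cong₂ _+_ (f≡g x) (∑-cong f≡g xs)

  ∑-zero : (xs : List X) → ∑[ x ∈ xs ] 0 ≡ 0
  ∑-zero [] = refl
  ∑-zero (x ∷ xs) = ∑-zero xs

  ∑-+ : (f g : X → ℕ) → ∀ xs → ∑[ x ∈ xs ] (f x + g x) ≡ ∑ xs f + ∑ xs g
  ∑-+ f g [] = refl
  ∑-+ f g (x ∷ xs) rewrite ∑-+ f g xs = interchange (f x) (g x) (∑ xs f) (∑ xs g)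
    where
    interchange : ∀ a b c d → a + b + (c + d) ≡ a + c + (b + d)
    interchange = solve-∀

  ∑-*ˡ : (a : ℕ) (f : X → ℕ) → ∀ xs → ∑[ x ∈ xs ] (a * f x) ≡ a * ∑ xs f
  ∑-*ˡ a f [] = sym (*-zeroʳ a)
  ∑-*ˡ a f (x ∷ xs) rewrite ∑-*ˡ a f xs = sym (*-distribˡ-+ a (f x) (∑ xs f))

  ∑-*ʳ : (a : ℕ) (f : X → ℕ) → ∀ xs → ∑[ x ∈ xs ] (f x * a) ≡ ∑ xs f * a
  ∑-*ʳ a f [] = refl
  ∑-*ʳ a f (x ∷ xs) rewrite ∑-*ʳ a f xs = sym (*-distribʳ-+ a (f x) (∑ xs f))

  ∑-≤-length* : {f : X → ℕ} {β : ℕ} {xs : List X} → All (λ x → f x ≤ β) xs → ∑ xs f ≤ length xs * β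
  ∑-≤-length* [] = z≤n
  ∑-≤-length* (fx≤β ∷ rest) = +-mono-≤ fx≤β (∑-≤-length* rest)

  length*-≤-∑ : {f : X → ℕ} {β : ℕ} {xs : List X} → All (λ x → β ≤ f x) xs → length xs * β ≤ ∑ xs f
  length*-≤-∑ [] = z≤n
  length*-≤-∑ (β≤fx ∷ rest) = +-mono-≤ β≤fx (length*-≤-∑ rest)

∑-comm : {X Y : Set} (g : X → Y → ℕ) → ∀ xs ys →
  ∑[ x ∈ xs ] ∑[ y ∈ ys ] g x y ≡ ∑[ y ∈ ys ] ∑[ x ∈ xs ] g x y
∑-comm g [] ys = sym (∑-zero ys)
∑-comm g (x ∷ xs) ys = begin
    ∑[ y ∈ ys ] g x y + ∑[ x ∈ xs ] ∑[ y ∈ ys ] g x y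
  ≡⟨ cong (∑[ y ∈ ys ] g x y +_) (∑-comm g xs ys) ⟩
    ∑[ y ∈ ys ] g x y + ∑[ y ∈ ys ] ∑[ x ∈ xs ] g x y
  ≡⟨ sym (∑-+ (g x) (λ y → ∑[ x ∈ xs ] g x y) ys) ⟩
    ∑[ y ∈ ys ] (g x y + ∑[ x ∈ xs ] g x y) ∎
  where open ≡-Reasoning

∑-square : {X : Set} (f : X → ℕ) → ∀ xs → ∑[ x ∈ xs ] ∑[ y ∈ xs ] (f x * f y) ≡ ∑ xs f * ∑ xs f
∑-square f xs = begin
    ∑[ x ∈ xs ] ∑[ y ∈ xs ] (f x * f y)  ≡⟨ ∑-cong (λ x → ∑-*ˡ (f x) f xs) xs ⟩
    ∑[ x ∈ xs ] (f x * ∑ xs f)           ≡⟨ ∑-*ʳ (∑ xs f) f xs ⟩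
    ∑ xs f * ∑ xs f                      ∎
  where open ≡-Reasoning

2*-≤-square-sum : ∀ a b → 2 * (a * b) ≤ a * a + b * b
2*-≤-square-sum a b with ≤-total a b
... | inj₁ a≤b with d , refl ← m≤n⇒∃[o]m+o≡n a≤b =
  subst (2 * (a * (a + d)) ≤_) (square-of-difference a d) (m≤m+n (2 * (a * (a + d))) (d * d))
  where
  square-of-difference : ∀ a d → 2 * (a * (a + d)) + d * d ≡ a * a + (a + d) * (a + d)
  square-of-difference = solve-∀
... | inj₂ b≤a with d , refl ← m≤n⇒∃[o]m+o≡n b≤a =
  subst (2 * ((b + d) * b) ≤_) (square-of-difference b d) (m≤m+n (2 * ((b + d) * b)) (d * d))
  where
  square-of-difference : ∀ b d → 2 * ((b + d) * b) + d * d ≡ (b + d) * (b + d) + b * b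
  square-of-difference = solve-∀

module _ {X : Set} (s : X → ℕ) where

  2*-≤-∑-square-sum : ∀ a xs → 2 * (a * ∑ xs s) ≤ ∑[ z ∈ xs ] (s z * s z) + length xs * (a * a)
  2*-≤-∑-square-sum a [] = subst (_≤ 0) (sym (cong (2 *_) (*-zeroʳ a))) z≤n
  2*-≤-∑-square-sum a (w ∷ xs) = begin
      2 * (a * (s w + ∑ xs s))
    ≡⟨ distribute a (s w) (∑ xs s) ⟩
      2 * (s w * a) + 2 * (a * ∑ xs s)
    ≤⟨ +-mono-≤ (2*-≤-square-sum (s w) a) (2*-≤-∑-square-sum a xs) ⟩
      (s w * s w + a * a) + (∑[ z ∈ xs ] (s z * s z) + length xs * (a * a))
    ≡⟨ collect (s w * s w) (a * a) (∑[ z ∈ xs ] (s z * s z)) (length xs) ⟩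
      s w * s w + ∑[ z ∈ xs ] (s z * s z) + suc (length xs) * (a * a) ∎
    where
    open ≤-Reasoning
    distribute : ∀ a b c → 2 * (a * (b + c)) ≡ 2 * (b * a) + 2 * (a * c)
    distribute = solve-∀
    collect : ∀ x y z l → (x + y) + (z + l * y) ≡ x + z + suc l * y
    collect = solve-∀

  cauchy-schwarz : ∀ xs → ∑ xs s * ∑ xs s ≤ length xs * ∑[ z ∈ xs ] (s z * s z)
  cauchy-schwarz [] = z≤n
  cauchy-schwarz (z ∷ xs) = begin
      (a + S) * (a + S)        ≡⟨ expand a S ⟩
      a * a + 2 * (a * S) + S * S
        ≤⟨ +-mono-≤ (+-monoʳ-≤ (a * a) (2*-≤-∑-square-sum a xs)) (cauchy-schwarz xs) ⟩
      a * a + (Q + ℓ * (a * a)) + ℓ * Q  ≡⟨ collect (a * a) Q ℓ ⟩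
      suc ℓ * (a * a + Q)      ∎
    where
    open ≤-Reasoning
    a = s z
    S = ∑ xs s
    Q = ∑[ z ∈ xs ] (s z * s z)
    ℓ = length xs
    expand : ∀ a S → (a + S) * (a + S) ≡ a * a + 2 * (a * S) + S * S
    expand = solve-∀
    collect : ∀ b Q ℓ → b + (Q + ℓ * b) + ℓ * Q ≡ suc ℓ * (b + Q)
    collect = solve-∀

infixr 6 _∩ᵇ_
_∩ᵇ_ : (ℕ → Bool) → (ℕ → Bool) → ℕ → Bool
(P ∩ᵇ Q) z = P z ∧ Q z

indicator : Bool → ℕ
indicator true = 1
indicator false = 0

indicator-∧ : ∀ a b → indicator (a ∧ b) ≡ indicator a * indicator b
indicator-∧ true b = sym (+-identityʳ (indicator b))
indicator-∧ false b = refl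

count≡∑-indicator : ∀ (P : ℕ → Bool) L → count P L ≡ ∑[ z ∈ L ] indicator (P z)
count≡∑-indicator P [] = refl
count≡∑-indicator P (x ∷ L) with P x
... | true = cong suc (count≡∑-indicator P L)
... | false = count≡∑-indicator P L

count-cong : ∀ {P Q : ℕ → Bool} → (∀ z → P z ≡ Q z) → ∀ L → count P L ≡ count Q L
count-cong {P} {Q} P≡Q L = begin
  count P L                    ≡⟨ count≡∑-indicator P L ⟩
  ∑[ z ∈ L ] indicator (P z)   ≡⟨ ∑-cong (λ z → cong indicator (P≡Q z)) L ⟩
  ∑[ z ∈ L ] indicator (Q z)   ≡⟨ count≡∑-indicator Q L ⟨
  count Q L                    ∎
  where open ≡-Reasoning

count≤length : ∀ (P : ℕ → Bool) L → count P L ≤ length L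
count≤length P [] = z≤n
count≤length P (x ∷ L) with P x
... | true = s≤s (count≤length P L)
... | false = m≤n⇒m≤1+n (count≤length P L)

count-+-≤-count-∩ᵇ : ∀ (P Q : ℕ → Bool) L → count P L + count Q L ≤ count (P ∩ᵇ Q) L + length L
count-+-≤-count-∩ᵇ P Q [] = z≤n
count-+-≤-count-∩ᵇ P Q (x ∷ L) with P x | Q x | count-+-≤-count-∩ᵇ P Q L
... | true  | true  | ih = subst₂ _≤_ (sym (+-suc _ (count Q L))) (sym (+-suc _ (length L))) (s≤s (s≤s ih))
... | true  | false | ih = subst (suc (count P L + count Q L) ≤_) (sym (+-suc _ (length L))) (s≤s ih)
... | false | true  | ih = subst₂ _≤_ (sym (+-suc (count P L) (count Q L))) (sym (+-suc _ (length L))) (s≤s ih)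
... | false | false | ih = ≤-trans ih (+-monoʳ-≤ _ (n≤1+n _))

count-pos⇒∃ : ∀ (P : ℕ → Bool) L → 0 < count P L → ∃[ y ] T (P y)
count-pos⇒∃ P (x ∷ L) pos with P x in Px≡true
... | true = x , subst T (sym Px≡true) tt
... | false = count-pos⇒∃ P L pos

module _ {X : Set} (c : X → X → ℕ) (a β ℓ : ℕ) (c-diagonal : ∀ x → c x x ≤ ℓ) (c-sym : ∀ x y → c x y ≡ c y x) where

  ∑∑-cons : ∀ x xs → ∑[ u ∈ x ∷ xs ] ∑[ v ∈ x ∷ xs ] c u v ≡
    c x x + ∑[ y ∈ xs ] c x y + ∑[ y ∈ xs ] c y x + ∑[ u ∈ xs ] ∑[ v ∈ xs ] c u v
  ∑∑-cons x xs = begin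
      (c x x + ∑[ y ∈ xs ] c x y) + ∑[ u ∈ xs ] (c u x + ∑[ v ∈ xs ] c u v)
    ≡⟨ cong (c x x + ∑[ y ∈ xs ] c x y +_) (∑-+ (λ u → c u x) (λ u → ∑[ v ∈ xs ] c u v) xs) ⟩
      (c x x + ∑[ y ∈ xs ] c x y) + (∑[ y ∈ xs ] c y x + ∑[ u ∈ xs ] ∑[ v ∈ xs ] c u v)
    ≡⟨ +-assoc (c x x + ∑[ y ∈ xs ] c x y) _ _ ⟨
      c x x + ∑[ y ∈ xs ] c x y + ∑[ y ∈ xs ] c y x + ∑[ u ∈ xs ] ∑[ v ∈ xs ] c u v ∎
    where open ≡-Reasoning

  ∑∑-≤-of-off-diagonal-≤ : ∀ xs → AllPairs (λ x y → a * c x y ≤ β) xs →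
    a * ∑[ u ∈ xs ] ∑[ v ∈ xs ] c u v + length xs * β ≤ a * length xs * ℓ + length xs * length xs * β
  ∑∑-≤-of-off-diagonal-≤ [] [] rewrite *-zeroʳ a = z≤n
  ∑∑-≤-of-off-diagonal-≤ (x ∷ xs) (row ∷ rest) = begin
      a * ∑[ u ∈ x ∷ xs ] ∑[ v ∈ x ∷ xs ] c u v + suc K * β
    ≡⟨ cong (λ t → a * t + suc K * β) (∑∑-cons x xs) ⟩
      a * (c x x + ∑[ y ∈ xs ] c x y + ∑[ y ∈ xs ] c y x + ∑[ u ∈ xs ] ∑[ v ∈ xs ] c u v) + suc K * β
    ≡⟨ distribute a (c x x) (∑[ y ∈ xs ] c x y) (∑[ y ∈ xs ] c y x) (∑[ u ∈ xs ] ∑[ v ∈ xs ] c u v) K β ⟩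
      a * c x x + a * ∑[ y ∈ xs ] c x y + a * ∑[ y ∈ xs ] c y x + (a * ∑[ u ∈ xs ] ∑[ v ∈ xs ] c u v + K * β) + β
    ≤⟨ +-monoˡ-≤ β (+-mono-≤ (+-mono-≤ (+-mono-≤ (*-monoʳ-≤ a (c-diagonal x)) row-bound) column-bound)
                              (∑∑-≤-of-off-diagonal-≤ xs rest)) ⟩
      a * ℓ + K * β + K * β + (a * K * ℓ + K * K * β) + β
    ≡⟨ collect a ℓ K β ⟩
      a * suc K * ℓ + suc K * suc K * β ∎
    where
    open ≤-Reasoning
    K = length xs
    row-bound : a * ∑[ y ∈ xs ] c x y ≤ K * β
    row-bound = subst (_≤ K * β) (∑-*ˡ a (c x) xs) (∑-≤-length* row)
    column-bound : a * ∑[ y ∈ xs ] c y x ≤ K * β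
    column-bound = subst (_≤ K * β) (cong (a *_) (∑-cong (c-sym x) xs)) row-bound
    distribute : ∀ a d s₁ s₂ s K β → a * (d + s₁ + s₂ + s) + suc K * β ≡ a * d + a * s₁ + a * s₂ + (a * s + K * β) + β
    distribute = solve-∀
    collect : ∀ a ℓ K β → a * ℓ + K * β + K * β + (a * K * ℓ + K * K * β) + β ≡ a * suc K * ℓ + suc K * suc K * β
    collect = solve-∀

module _ (F : ℕ → ℕ → Bool) (L : List ℕ) (xs : List ℕ) where

  multiplicity : ℕ → ℕ
  multiplicity z = ∑[ x ∈ xs ] indicator (F x z)

  ∑-count≡∑-multiplicity : ∑[ x ∈ xs ] count (F x) L ≡ ∑ L multiplicity
  ∑-count≡∑-multiplicity = trans (∑-cong (λ x → count≡∑-indicator (F x) L) xs) (∑-comm (λ x z → indicator (F x z)) xs L)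

  ∑∑-count-∩ᵇ≡∑-multiplicity² :
    ∑[ x ∈ xs ] ∑[ y ∈ xs ] count (F x ∩ᵇ F y) L ≡ ∑[ z ∈ L ] (multiplicity z * multiplicity z)
  ∑∑-count-∩ᵇ≡∑-multiplicity² = begin
      ∑[ x ∈ xs ] ∑[ y ∈ xs ] count (F x ∩ᵇ F y) L
    ≡⟨ ∑-cong (λ x → ∑-cong (λ y → trans (count≡∑-indicator (F x ∩ᵇ F y) L) (∑-cong (λ z → indicator-∧ (F x z) (F y z)) L)) xs) xs ⟩
      ∑[ x ∈ xs ] ∑[ y ∈ xs ] ∑[ z ∈ L ] (𝟙 x z * 𝟙 y z)
    ≡⟨ ∑-cong (λ x → ∑-comm (λ y z → 𝟙 x z * 𝟙 y z) xs L) xs ⟩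
      ∑[ x ∈ xs ] ∑[ z ∈ L ] ∑[ y ∈ xs ] (𝟙 x z * 𝟙 y z)
    ≡⟨ ∑-comm (λ x z → ∑[ y ∈ xs ] (𝟙 x z * 𝟙 y z)) xs L ⟩
      ∑[ z ∈ L ] ∑[ x ∈ xs ] ∑[ y ∈ xs ] (𝟙 x z * 𝟙 y z)
    ≡⟨ ∑-cong (λ z → ∑-square (λ x → 𝟙 x z) xs) L ⟩
      ∑[ z ∈ L ] (multiplicity z * multiplicity z) ∎
    where
    open ≡-Reasoning
    𝟙 : ℕ → ℕ → ℕ
    𝟙 x z = indicator (F x z)

  ∑-count²-≤ : (∑[ x ∈ xs ] count (F x) L) * (∑[ x ∈ xs ] count (F x) L) ≤
               length L * ∑[ x ∈ xs ] ∑[ y ∈ xs ] count (F x ∩ᵇ F y) L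
  ∑-count²-≤ = subst₂ (λ u v → u * u ≤ length L * v) (sym ∑-count≡∑-multiplicity) (sym ∑∑-count-∩ᵇ≡∑-multiplicity²)
    (cauchy-schwarz multiplicity L)

-- With a = 2q² sets of density ≥ p/q in a window of size ℓ, the sum S₁ of their sizes and the
-- sum S₂ of their pairwise intersections satisfy a p ℓ ≤ q S₁, S₁² ≤ ℓ S₂ (Cauchy–Schwarz) and,
-- if all pairs have density ≤ p²/a, a S₂ ≤ a² ℓ + a(a - 1) p² ℓ; together a p² + p² ≤ a.
dense-family-inequalities-absurd : ∀ p q ℓ S₁ S₂ → 1 ≤ p → 1 ≤ q → 0 < ℓ →
  let a = 2 * (q * q) in
  a * (p * ℓ) ≤ q * S₁ → S₁ * S₁ ≤ ℓ * S₂ → a * S₂ + a * (p * p * ℓ) ≤ a * a * ℓ + a * a * (p * p * ℓ) → ⊥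
dense-family-inequalities-absurd p q ℓ S₁ S₂ 1≤p 1≤q 0<ℓ lower cs upper = <-irrefl refl (≤-trans a<p²a+p² p²a+p²≤a)
  where
  open ≤-Reasoning
  a = 2 * (q * q)
  β = p * p * ℓ
  a²p²ℓ² = a * a * (p * p) * (ℓ * ℓ)
  0<aℓ² : 0 < a * (ℓ * ℓ)
  0<aℓ² = *-mono-≤ (≤-trans (s≤s z≤n) (*-monoʳ-≤ 2 (*-mono-≤ 1≤q 1≤q))) (*-mono-≤ 0<ℓ 0<ℓ)
  squared : 2 * (a * (p * ℓ) * (a * (p * ℓ))) ≤ ℓ * (a * S₂)
  squared = begin
    2 * (a * (p * ℓ) * (a * (p * ℓ)))  ≤⟨ *-monoʳ-≤ 2 (*-mono-≤ lower lower) ⟩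
    2 * (q * S₁ * (q * S₁))            ≡⟨ regroup-square q S₁ ⟩
    a * (S₁ * S₁)                      ≤⟨ *-monoʳ-≤ a cs ⟩
    a * (ℓ * S₂)                       ≡⟨ regroup-product a ℓ S₂ ⟩
    ℓ * (a * S₂)                       ∎
    where
    regroup-square : ∀ q S₁ → 2 * (q * S₁ * (q * S₁)) ≡ 2 * (q * q) * (S₁ * S₁)
    regroup-square = solve-∀
    regroup-product : ∀ a ℓ S₂ → a * (ℓ * S₂) ≡ ℓ * (a * S₂)
    regroup-product = solve-∀
  combined : (a * (p * p) + p * p) * (a * (ℓ * ℓ)) + a²p²ℓ² ≤ a * (a * (ℓ * ℓ)) + a²p²ℓ²
  combined = begin
    (a * (p * p) + p * p) * (a * (ℓ * ℓ)) + a²p²ℓ²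
      ≡⟨ expand-left a p ℓ ⟩
    2 * (a * (p * ℓ) * (a * (p * ℓ))) + ℓ * (a * β)
      ≤⟨ +-monoˡ-≤ _ squared ⟩
    ℓ * (a * S₂) + ℓ * (a * β)
      ≡⟨ *-distribˡ-+ ℓ _ _ ⟨
    ℓ * (a * S₂ + a * β)
      ≤⟨ *-monoʳ-≤ ℓ upper ⟩
    ℓ * (a * a * ℓ + a * a * β)
      ≡⟨ expand-right a p ℓ ⟩
    a * (a * (ℓ * ℓ)) + a²p²ℓ² ∎
    where
    expand-left : ∀ a p ℓ → (a * (p * p) + p * p) * (a * (ℓ * ℓ)) + a * a * (p * p) * (ℓ * ℓ)
                          ≡ 2 * (a * (p * ℓ) * (a * (p * ℓ))) + ℓ * (a * (p * p * ℓ))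
    expand-left = solve-∀
    expand-right : ∀ a p ℓ → ℓ * (a * a * ℓ + a * a * (p * p * ℓ)) ≡ a * (a * (ℓ * ℓ)) + a * a * (p * p) * (ℓ * ℓ)
    expand-right = solve-∀
  p²a+p²≤a : a * (p * p) + p * p ≤ a
  p²a+p²≤a = *-cancelʳ-≤ _ _ (a * (ℓ * ℓ)) {{>-nonZero 0<aℓ²}} (+-cancelʳ-≤ a²p²ℓ² _ _ combined)
  a<p²a+p² : a < a * (p * p) + p * p
  a<p²a+p² = subst (_≤ a * (p * p) + p * p) (+-comm a 1)
               (+-mono-≤ (subst (_≤ a * (p * p)) (*-identityʳ a) (*-monoʳ-≤ a 1≤p²)) 1≤p²)
    where
    1≤p² : 1 ≤ p * p
    1≤p² = *-mono-≤ 1≤p 1≤p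

dense-family-has-dense-pair : (F : ℕ → ℕ → Bool) (L : List ℕ) (p q : ℕ) → 1 ≤ p → 1 ≤ q → 0 < length L →
  (xs : List ℕ) → length xs ≡ 2 * (q * q) →
  All (λ x → p * length L ≤ q * count (F x) L) xs →
  ¬ AllPairs (λ x y → 2 * (q * q) * count (F x ∩ᵇ F y) L ≤ p * p * length L) xs
dense-family-has-dense-pair F L p q 1≤p 1≤q 0<ℓ xs |xs|≡a dense sparse-pairs =
  dense-family-inequalities-absurd p q ℓ S₁ (∑[ x ∈ xs ] ∑[ y ∈ xs ] c x y) 1≤p 1≤q 0<ℓ
    (subst (λ K → K * (p * ℓ) ≤ q * S₁) |xs|≡a (subst (length xs * (p * ℓ) ≤_) (∑-*ˡ q (λ x → count (F x) L) xs) (length*-≤-∑ dense)))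
    (∑-count²-≤ F L xs)
    (subst (λ K → a * ∑[ x ∈ xs ] ∑[ y ∈ xs ] c x y + K * (p * p * ℓ) ≤ a * K * ℓ + K * K * (p * p * ℓ)) |xs|≡a
      (∑∑-≤-of-off-diagonal-≤ c a (p * p * ℓ) ℓ (λ x → count≤length (F x ∩ᵇ F x) L)
        (λ x y → count-cong (λ z → ∧-comm (F x z) (F y z)) L) xs sparse-pairs))
  where
  ℓ = length L
  a = 2 * (q * q)
  S₁ = ∑[ x ∈ xs ] count (F x) L
  c : ℕ → ℕ → ℕ
  c x y = count (F x ∩ᵇ F y) L

Eventually : Pred ℕ 0ℓ → Pred ℕ 0ℓ → Set
Eventually M P = ∃[ N₀ ] (∀ N → N₀ ≤ N → M N → P N)

module _ {M P : Pred ℕ 0ℓ} where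

  Eventually-restrict : ∀ {M′} → M′ ⊆ M → Eventually M P → Eventually M′ P
  Eventually-restrict M′⊆M (N₀ , h) = N₀ , λ N N₀≤N N∈M′ → h N N₀≤N (M′⊆M N∈M′)

  Eventually-map : ∀ {Q} → P ⊆ Q → Eventually M P → Eventually M Q
  Eventually-map P⊆Q (N₀ , h) = N₀ , λ N N₀≤N N∈M → P⊆Q (h N N₀≤N N∈M)

  Eventually-∩ : ∀ {Q} → Eventually M P → Eventually M Q → Eventually M (P ∩ Q)
  Eventually-∩ (N₀ , h) (N₁ , g) =
    N₀ ⊔ N₁ , λ N le N∈M → h N (≤-trans (m≤m⊔n N₀ N₁) le) N∈M , g N (≤-trans (m≤n⊔m N₀ N₁) le) N∈M

  Infinite-Eventually⇒∃ : Infinite M → Eventually M P → ∀ n → ∃[ N ] (n ≤ N × M N × P N)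
  Infinite-Eventually⇒∃ M-infinite (N₀ , h) n with M-infinite (n ⊔ N₀)
  ... | N , le , N∈M = N , ≤-trans (m≤m⊔n n N₀) le , N∈M , h N (≤-trans (m≤n⊔m n N₀) le) N∈M

module _ {M : Pred ℕ 0ℓ} {P : ℕ → Pred ℕ 0ℓ} where

  Eventually-All : ∀ xs → All (λ x → Eventually M (P x)) xs → Eventually M (λ N → All (λ x → P x N) xs)
  Eventually-All [] [] = 0 , λ _ _ _ → []
  Eventually-All (x ∷ xs) (h ∷ hs) =
    Eventually-map (λ (Px , Pxs) → Px ∷ Pxs) (Eventually-∩ h (Eventually-All xs hs))

Eventually-AllPairs : ∀ {M} {R : ℕ → ℕ → Pred ℕ 0ℓ} xs →
  AllPairs (λ x y → Eventually M (R x y)) xs → Eventually M (λ N → AllPairs (λ x y → R x y N) xs)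
Eventually-AllPairs [] [] = 0 , λ _ _ _ → []
Eventually-AllPairs (x ∷ xs) (h ∷ hs) =
  Eventually-map (λ (Rx , Rxs) → Rx ∷ Rxs) (Eventually-∩ (Eventually-All xs h) (Eventually-AllPairs xs hs))

record Dichotomy (M J : Pred ℕ 0ℓ) (P : ℕ → Pred ℕ 0ℓ) : Set₁ where
  field
    M′ : Pred ℕ 0ℓ
    M′-infinite : Infinite M′
    M′⊆M : M′ ⊆ M
    J′ : Pred ℕ 0ℓ
    J′-infinite : Infinite J′
    J′⊆J : J′ ⊆ J
    outcome : (∀ {m} → J′ m → Eventually M′ (P m)) ⊎ (∀ {m} → J′ m → Eventually M′ (∁ (P m)))

module _ (em : ExcludedMiddle 0ℓ) where

  ¬Infinite⇒bounded : ∀ {X : Pred ℕ 0ℓ} → ¬ Infinite X → ∃[ n ] (∀ b → n ≤ b → ¬ X b)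
  ¬Infinite⇒bounded {X} ¬inf with em {∃[ n ] (∀ b → n ≤ b → ¬ X b)}
  ... | yes bounded = bounded
  ... | no ¬bounded = ⊥-elim (¬inf element-above)
    where
    element-above : Infinite X
    element-above n with em {∃[ b ] (n ≤ b × X b)}
    ... | yes found = found
    ... | no none = ⊥-elim (¬bounded (n , λ b n≤b Xb → none (b , n≤b , Xb)))

  -- Stage m + 1 keeps only the N with P m N whenever infinitely many of stage m do; the diagonal
  -- D takes its k-th element from stage k, so it lies eventually in every stage.
  module Diagonal (M : Pred ℕ 0ℓ) (M-infinite : Infinite M) (P : ℕ → Pred ℕ 0ℓ) where

    FrequentIn : Pred ℕ 0ℓ → ℕ → Set
    FrequentIn S m = Infinite (S ∩ P m)

    refine : (S : Pred ℕ 0ℓ) (m : ℕ) → Dec (FrequentIn S m) → Pred ℕ 0ℓ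
    refine S m (yes _) = S ∩ P m
    refine S m (no _) = S

    stage : ℕ → Pred ℕ 0ℓ
    stage zero = M
    stage (suc m) = refine (stage m) m (em {FrequentIn (stage m) m})

    Frequent : Pred ℕ 0ℓ
    Frequent m = FrequentIn (stage m) m

    stage-infinite : ∀ m → Infinite (stage m)
    stage-infinite zero = M-infinite
    stage-infinite (suc m) with em {Frequent m}
    ... | yes frequent = frequent
    ... | no _ = stage-infinite m

    stage-suc⊆stage : ∀ m → stage (suc m) ⊆ stage m
    stage-suc⊆stage m with em {Frequent m}
    ... | yes _ = proj₁
    ... | no _ = λ N∈S → N∈S

    stage-+⊆stage : ∀ j e → stage (e + j) ⊆ stage j
    stage-+⊆stage j zero = λ N∈S → N∈S
    stage-+⊆stage j (suc e) = λ N∈S → stage-+⊆stage j e (stage-suc⊆stage (e + j) N∈S)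

    stage-antitone : ∀ {j k} → j ≤ k → stage k ⊆ stage j
    stage-antitone {j} j≤k {N} with e , refl ← m≤n⇒∃[o]m+o≡n j≤k =
      λ N∈S → stage-+⊆stage j e (subst (λ t → stage t N) (+-comm j e) N∈S)

    stage-suc⊆P : ∀ m → Frequent m → stage (suc m) ⊆ P m
    stage-suc⊆P m frequent with em {Frequent m}
    ... | yes _ = proj₂
    ... | no infrequent = ⊥-elim (infrequent frequent)

    diagonal : ℕ → ℕ
    diagonal zero = proj₁ (stage-infinite 0 0)
    diagonal (suc k) = proj₁ (stage-infinite (suc k) (suc (diagonal k)))

    diagonal∈stage : ∀ k → stage k (diagonal k)
    diagonal∈stage zero = proj₂ (proj₂ (stage-infinite 0 0))
    diagonal∈stage (suc k) = proj₂ (proj₂ (stage-infinite (suc k) (suc (diagonal k))))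

    diagonal-<-suc : ∀ k → diagonal k < diagonal (suc k)
    diagonal-<-suc k = proj₁ (proj₂ (stage-infinite (suc k) (suc (diagonal k))))

    diagonal-strictMono : ∀ j k → j < k → diagonal j < diagonal k
    diagonal-strictMono j (suc k) (s≤s j≤k) with m≤n⇒m<n∨m≡n j≤k
    ... | inj₁ j<k = <-trans (diagonal-strictMono j k j<k) (diagonal-<-suc k)
    ... | inj₂ refl = diagonal-<-suc k

    n≤diagonal : ∀ k → k ≤ diagonal k
    n≤diagonal zero = z≤n
    n≤diagonal (suc k) = ≤-trans (s≤s (n≤diagonal k)) (diagonal-<-suc k)

    D : Pred ℕ 0ℓ
    D N = ∃[ k ] (diagonal k ≡ N)

    D-infinite : Infinite D
    D-infinite n = diagonal n , n≤diagonal n , n , refl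

    D⊆M : D ⊆ M
    D⊆M (k , refl) = stage-antitone {k = k} z≤n (diagonal∈stage k)

    D-beyond⊆stage : ∀ m N → diagonal m ≤ N → D N → stage m N
    D-beyond⊆stage m N le (k , refl) with m ≤? k
    ... | yes m≤k = stage-antitone m≤k (diagonal∈stage k)
    ... | no m≰k = ⊥-elim (<-irrefl refl (<-≤-trans (diagonal-strictMono k m (≰⇒> m≰k)) le))

    frequent⇒Eventually : ∀ m → Frequent m → Eventually D (P m)
    frequent⇒Eventually m frequent =
      diagonal (suc m) , λ N le N∈D → stage-suc⊆P m frequent (D-beyond⊆stage (suc m) N le N∈D)

    infrequent⇒Eventually-∁ : ∀ m → ¬ Frequent m → Eventually D (∁ (P m))
    infrequent⇒Eventually-∁ m infrequent with n₀ , beyond ← ¬Infinite⇒bounded infrequent =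
      n₀ ⊔ diagonal m , λ N le N∈D PmN →
        beyond N (≤-trans (m≤m⊔n n₀ _) le) (D-beyond⊆stage m N (≤-trans (m≤n⊔m n₀ _) le) N∈D , PmN)

    dichotomy : (J : Pred ℕ 0ℓ) → Infinite J → Dichotomy M J P
    dichotomy J J-infinite with em {Infinite (J ∩ Frequent)}
    ... | yes frequent-infinite = record
      { M′ = D ; M′-infinite = D-infinite ; M′⊆M = D⊆M
      ; J′ = J ∩ Frequent ; J′-infinite = frequent-infinite ; J′⊆J = proj₁
      ; outcome = inj₁ λ (_ , frequent) → frequent⇒Eventually _ frequent }
    ... | no ¬frequent-infinite with n₀ , beyond ← ¬Infinite⇒bounded ¬frequent-infinite = record
      { M′ = D ; M′-infinite = D-infinite ; M′⊆M = D⊆M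
      ; J′ = J ∩ ∁ Frequent ; J′-infinite = infrequent-infinite ; J′⊆J = proj₁
      ; outcome = inj₂ λ (_ , infrequent) → infrequent⇒Eventually-∁ _ infrequent }
      where
      infrequent-infinite : Infinite (J ∩ ∁ Frequent)
      infrequent-infinite n with m , le , m∈J ← J-infinite (n ⊔ n₀) =
        m , ≤-trans (m≤m⊔n n n₀) le , m∈J , λ frequent → beyond m (≤-trans (m≤n⊔m n n₀) le) (m∈J , frequent)

  dichotomy : (M : Pred ℕ 0ℓ) → Infinite M → (P : ℕ → Pred ℕ 0ℓ) → (J : Pred ℕ 0ℓ) → Infinite J → Dichotomy M J P
  dichotomy M M-infinite P = Diagonal.dichotomy M M-infinite P

fraction-<-≤-trans : ∀ p q p′ q′ d m → 1 ≤ q′ → p * q′ < p′ * q → p′ * d < q′ * m → p * d ≤ q * m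
fraction-<-≤-trans p q p′ q′ d m 1≤q′ p/q<p′/q′ p′/q′<m/d = *-cancelˡ-≤ q′ {{>-nonZero 1≤q′}} (begin
    q′ * (p * d)  ≡⟨ regroup₁ q′ p d ⟩
    (p * q′) * d  ≤⟨ *-monoˡ-≤ d (<⇒≤ p/q<p′/q′) ⟩
    (p′ * q) * d  ≡⟨ regroup₂ p′ q d ⟩
    q * (p′ * d)  ≤⟨ *-monoʳ-≤ q (<⇒≤ p′/q′<m/d) ⟩
    q * (q′ * m)  ≡⟨ regroup₃ q q′ m ⟩
    q′ * (q * m)  ∎)
  where
  open ≤-Reasoning
  regroup₁ : ∀ a b c → a * (b * c) ≡ (b * a) * c
  regroup₁ a b c = trans (sym (*-assoc a b c)) (cong (_* c) (*-comm a b))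
  regroup₂ : ∀ a b c → (a * b) * c ≡ b * (a * c)
  regroup₂ a b c = trans (cong (_* c) (*-comm a b)) (*-assoc b a c)
  regroup₃ : ∀ a b c → a * (b * c) ≡ b * (a * c)
  regroup₃ a b c = trans (regroup₁ a b c) (*-assoc b a c)

fractions-overlap : ∀ p q ℓ x y z → 1 ≤ p → 1 ≤ q → p * ℓ ≤ q * x → (q ∸ 1) * ℓ < q * y → x + y ≤ z + ℓ → 0 < z
fractions-overlap p (suc q′) ℓ x y (suc z) _ _ _ _ _ = s≤s z≤n
fractions-overlap p (suc q′) ℓ x y zero 1≤p _ dense almost-full x+y≤ℓ = ⊥-elim (<-irrefl refl (<-≤-trans lower upper))
  where
  lower : ℓ + q′ * ℓ < suc q′ * (x + y)
  lower = subst (ℓ + q′ * ℓ <_) (sym (*-distribˡ-+ (suc q′) x y))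
            (+-mono-≤-< (≤-trans (subst (_≤ p * ℓ) (*-identityˡ ℓ) (*-monoˡ-≤ ℓ 1≤p)) dense) almost-full)
  upper : suc q′ * (x + y) ≤ ℓ + q′ * ℓ
  upper = *-monoʳ-≤ (suc q′) x+y≤ℓ

∧-restrict-comm : ∀ e u v → (e ∧ v) ∧ u ≡ (e ∧ u) ∧ (e ∧ v)
∧-restrict-comm true u v = ∧-comm v u
∧-restrict-comm false u v = refl

module Construction (em : ExcludedMiddle 0ℓ) (A : ℕ → ℕ → Bool) (Φ : ℕ → List ℕ) (folner : IsFolner Φ) where

  RatioAtLeast : (ℕ → Bool) → ℕ → ℕ → Pred ℕ 0ℓ
  RatioAtLeast E p q N = p * den Φ N ≤ q * num Φ E N

  record Configuration (E : ℕ → Bool) : Set₁ where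
    field
      p q : ℕ
      1≤p : 1 ≤ p
      1≤q : 1 ≤ q
      rows : Pred ℕ 0ℓ
      rows-infinite : Infinite rows
      windows : Pred ℕ 0ℓ
      windows-infinite : Infinite windows
      rows-dense : ∀ {n} → rows n → Eventually windows (RatioAtLeast (E ∩ᵇ A n) p q)

  record Extension (E : ℕ → Bool) (bound : ℕ) : Set₁ where
    field
      b : ℕ
      bound<b : bound < b
      configuration : Configuration (E ∩ᵇ A b)

  Eventually-den-pos : Eventually U (λ N → 0 < den Φ N)
  Eventually-den-pos with N₀ , overlap-pos ← proj₂ folner 0 1 (s≤s z≤n) =
    N₀ , λ N N₀≤N _ → ≤-trans (subst (0 <_) (+-identityʳ _) (overlap-pos N N₀≤N)) (count≤length _ (Φ N))

  module Extend {E : ℕ → Bool} (C : Configuration E) (bound : ℕ) where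
    open Configuration C using (p; q; 1≤p; 1≤q)

    a p² : ℕ
    a = 2 * (q * q)
    p² = p * p

    DensePair : ℕ → ℕ → Pred ℕ 0ℓ
    DensePair x m = RatioAtLeast ((E ∩ᵇ A x) ∩ᵇ A m) p² a

    SparsePair : ℕ → ℕ → Pred ℕ 0ℓ
    SparsePair x m N = a * num Φ ((E ∩ᵇ A x) ∩ᵇ A m) N ≤ p² * den Φ N

    record SparseFamily (k : ℕ) : Set₁ where
      field
        members : List ℕ
        length-members : length members ≡ k
        windows′ : Pred ℕ 0ℓ
        windows′-infinite : Infinite windows′
        candidates : Pred ℕ 0ℓ
        candidates-infinite : Infinite candidates
        bound<candidate : ∀ {n} → candidates n → bound < n
        candidates-dense : ∀ {n} → candidates n → Eventually windows′ (RatioAtLeast (E ∩ᵇ A n) p q)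
        members-dense : All (λ x → Eventually windows′ (RatioAtLeast (E ∩ᵇ A x) p q)) members
        members-sparse : AllPairs (λ x y → Eventually windows′ (SparsePair y x)) members
        candidates-sparse : ∀ {n} → candidates n → All (λ y → Eventually windows′ (SparsePair y n)) members

    empty-family : SparseFamily 0
    empty-family = record
      { members = [] ; length-members = refl
      ; windows′ = Configuration.windows C ; windows′-infinite = Configuration.windows-infinite C
      ; candidates = Configuration.rows C ∩ (bound <_)
      ; candidates-infinite = λ n → let (m , le , m∈rows) = Configuration.rows-infinite C (n ⊔ suc bound) in
          m , ≤-trans (m≤m⊔n n _) le , m∈rows , ≤-trans (m≤n⊔m n _) le
      ; bound<candidate = proj₂ ; candidates-dense = λ (n∈rows , _) → Configuration.rows-dense C n∈rows
      ; members-dense = [] ; members-sparse = [] ; candidates-sparse = λ _ → [] }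

    -- Either some candidate x stays densely intersected by infinitely many candidates (then x
    -- extends E), or x joins the family after thinning out the candidates and windows.
    grow : ∀ {k} → SparseFamily k → SparseFamily (suc k) ⊎ Extension E bound
    grow {k} F with x , _ , x∈cand ← SparseFamily.candidates-infinite F 0 =
      decide (Dichotomy.outcome split)
      where
      open SparseFamily F
      split = dichotomy em windows′ windows′-infinite (DensePair x) candidates candidates-infinite
      open Dichotomy split
      decide : (∀ {m} → J′ m → Eventually M′ (DensePair x m)) ⊎ (∀ {m} → J′ m → Eventually M′ (∁ (DensePair x m)))
             → SparseFamily (suc k) ⊎ Extension E bound
      decide (inj₁ dense) = inj₂ record
        { b = x ; bound<b = bound<candidate x∈cand ; configuration = record
          { p = p² ; q = a ; 1≤p = *-mono-≤ 1≤p 1≤p ; 1≤q = ≤-trans (s≤s z≤n) (*-monoʳ-≤ 2 (*-mono-≤ 1≤q 1≤q))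
          ; rows = J′ ; rows-infinite = J′-infinite ; windows = M′ ; windows-infinite = M′-infinite
          ; rows-dense = dense } }
      decide (inj₂ sparse) = inj₁ record
        { members = x ∷ members ; length-members = cong suc length-members
        ; windows′ = M′ ; windows′-infinite = M′-infinite
        ; candidates = J′ ; candidates-infinite = J′-infinite
        ; bound<candidate = λ n∈J′ → bound<candidate (J′⊆J n∈J′)
        ; candidates-dense = λ n∈J′ → restrict (candidates-dense (J′⊆J n∈J′))
        ; members-dense = restrict (candidates-dense x∈cand) ∷ All.map restrict members-dense
        ; members-sparse = All.map restrict (candidates-sparse x∈cand) ∷ AllPairs.map restrict members-sparse
        ; candidates-sparse = λ n∈J′ →
            Eventually-map (λ ¬dense → <⇒≤ (≰⇒> ¬dense)) (sparse n∈J′) ∷ All.map restrict (candidates-sparse (J′⊆J n∈J′)) }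
        where
        restrict : ∀ {P} → Eventually windows′ P → Eventually M′ P
        restrict = Eventually-restrict M′⊆M

    families-or-extension : ∀ k → SparseFamily k ⊎ Extension E bound
    families-or-extension zero = inj₁ empty-family
    families-or-extension (suc k) with families-or-extension k
    ... | inj₁ F = grow F
    ... | inj₂ extension = inj₂ extension

    no-family-of-size-a : ¬ SparseFamily a
    no-family-of-size-a F = refute (Infinite-Eventually⇒∃ windows′-infinite dense-sparse-eventually 0)
      where
      open SparseFamily F
      DenseSparseWindow : Pred ℕ 0ℓ
      DenseSparseWindow N = 0 < den Φ N × All (λ x → RatioAtLeast (E ∩ᵇ A x) p q N) members
                                         × AllPairs (λ x y → SparsePair y x N) members
      dense-sparse-eventually : Eventually windows′ DenseSparseWindow
      dense-sparse-eventually = Eventually-∩ (Eventually-restrict (λ _ → tt) Eventually-den-pos)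
        (Eventually-∩ (Eventually-All members members-dense) (Eventually-AllPairs members members-sparse))
      refute : ∃[ N ] (0 ≤ N × windows′ N × DenseSparseWindow N) → ⊥
      refute (N , _ , _ , 0<ℓ , dense , sparse) =
        dense-family-has-dense-pair (λ x → E ∩ᵇ A x) (Φ N) p q 1≤p 1≤q 0<ℓ members length-members dense
          (AllPairs.map (λ {x} {y} → subst (λ c → a * c ≤ p² * den Φ N)
             (count-cong (λ z → ∧-restrict-comm (E z) (A x z) (A y z)) (Φ N))) sparse)

    extension : Extension E bound
    extension with families-or-extension a
    ... | inj₁ F = ⊥-elim (no-family-of-size-a F)
    ... | inj₂ ext = ext

  element-beyond : ∀ {E} → Configuration E → ∀ t → ∃[ c ] (t < c × T (E c))
  element-beyond {E} C t = beyond-in (Infinite-Eventually⇒∃ windows-infinite dense-and-almost-shift-invariant 0)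
    where
    open Configuration C
    n : ℕ
    n = proj₁ (rows-infinite 0)
    Shifted : ℕ → ℕ → Bool
    Shifted N y = (suc t ≤ᵇ y) ∧ ((y ∸ suc t) ∈ᵇ Φ N)
    GoodWindow : Pred ℕ 0ℓ
    GoodWindow N = RatioAtLeast (E ∩ᵇ A n) p q N × (q ∸ 1) * den Φ N < q * shiftOverlap (Φ N) (suc t)
    dense-and-almost-shift-invariant : Eventually windows GoodWindow
    dense-and-almost-shift-invariant = Eventually-∩ (rows-dense (proj₂ (proj₂ (rows-infinite 0))))
      (Eventually-restrict (λ _ → tt) (map₂ (λ h N le _ → h N le) (proj₂ folner (suc t) q 1≤q)))
    beyond-in : ∃[ N ] (0 ≤ N × windows N × GoodWindow N) → ∃[ c ] (t < c × T (E c))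
    beyond-in (N , _ , _ , dense , almost-full)
      with y , y∈∩ ← count-pos⇒∃ ((E ∩ᵇ A n) ∩ᵇ Shifted N) (Φ N)
             (fractions-overlap p q (den Φ N) _ _ _ 1≤p 1≤q dense almost-full
               (count-+-≤-count-∩ᵇ (E ∩ᵇ A n) (Shifted N) (Φ N)))
      with y∈EAn , y∈shifted ← Equivalence.to T-∧ y∈∩
      = y , ≤ᵇ⇒≤ (suc t) y (proj₁ (Equivalence.to T-∧ y∈shifted)) , proj₁ (Equivalence.to T-∧ y∈EAn)

  record Stage : Set₁ where
    field
      E : ℕ → Bool
      configuration : Configuration E
      last : ℕ

    extension : Extension E last
    extension = Extend.extension configuration last

  next : Stage → Stage
  next s = record
    { E = E ∩ᵇ A b ; configuration = configuration′ ; last = proj₁ (element-beyond configuration′ b) }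
    where
    open Stage s
    open Extension extension renaming (configuration to configuration′)

  initial-stage : LimsupPositive Φ A → Stage
  initial-stage (p , q , 1≤p , 1≤q , dense-rows-infinite) = record
    { E = λ _ → true ; last = 0 ; configuration = record
      { p = p ; q = q ; 1≤p = 1≤p ; 1≤q = 1≤q
      ; rows = λ n → DensityAbove Φ (A n) p q ; rows-infinite = dense-rows-infinite
      ; windows = U ; windows-infinite = λ n → n , ≤-refl , tt
      ; rows-dense = λ (p′ , q′ , 1≤q′ , p/q<p′/q′ , N₀ , above) →
          N₀ , λ N N₀≤N _ → fraction-<-≤-trans p q p′ q′ (den Φ N) (num Φ (A _) N) 1≤q′ p/q<p′/q′ (above N N₀≤N) } }

  module Chain (s₀ : Stage) where

    stage : ℕ → Stage
    stage zero = s₀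
    stage (suc k) = next (stage k)

    E : ℕ → ℕ → Bool
    E k = Stage.E (stage k)

    last : ℕ → ℕ
    last k = Stage.last (stage k)

    b c : ℕ → ℕ
    b k = Extension.b (Stage.extension (stage k))
    c k = last (suc k)

    last<b : ∀ k → last k < b k
    last<b k = Extension.bound<b (Stage.extension (stage k))

    b<c : ∀ k → b k < c k
    b<c k = proj₁ (proj₂ (element-beyond (Extension.configuration (Stage.extension (stage k))) (b k)))

    c∈E : ∀ k → T (E (suc k) (c k))
    c∈E k = proj₂ (proj₂ (element-beyond (Extension.configuration (Stage.extension (stage k))) (b k)))

    last-<-suc : ∀ k → last k < last (suc k)
    last-<-suc k = <-trans (last<b k) (b<c k)

    last-mono : ∀ {i j} → i ≤ j → last i ≤ last j
    last-mono {i} {j} i≤j with e , refl ← m≤n⇒∃[o]m+o≡n i≤j = go e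
      where
      go : ∀ e → last i ≤ last (i + e)
      go zero = ≤-reflexive (cong last (sym (+-identityʳ i)))
      go (suc e) = ≤-trans (go e) (subst (λ k → last (i + e) ≤ last k) (sym (+-suc i e)) (<⇒≤ (last-<-suc (i + e))))

    k≤last : ∀ k → k ≤ last k
    k≤last zero = z≤n
    k≤last (suc k) = ≤-trans (s≤s (k≤last k)) (last-<-suc k)

    E-antitone : ∀ {i j} → i ≤ j → ∀ z → T (E j z) → T (E i z)
    E-antitone {i} {j} i≤j z with e , refl ← m≤n⇒∃[o]m+o≡n i≤j = go e
      where
      go : ∀ e → T (E (i + e) z) → T (E i z)
      go zero = subst (λ k → T (E k z)) (+-identityʳ i)
      go (suc e) z∈E = go e (proj₁ (Equivalence.to T-∧ (subst (λ k → T (E k z)) (+-suc i e) z∈E)))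

    c∈A-b : ∀ {i j} → i ≤ j → T (A (b i) (c j))
    c∈A-b {i} {j} i≤j = proj₂ (Equivalence.to (T-∧ {E i (c j)}) (E-antitone (s≤s i≤j) (c j) (c∈E j)))

    b<c⇒≤ : ∀ {i j} → b i < c j → i ≤ j
    b<c⇒≤ {i} {j} b<c′ with i ≤? j
    ... | yes i≤j = i≤j
    ... | no i≰j = ⊥-elim (<-irrefl refl (<-trans b<c′ (≤-<-trans (last-mono (≰⇒> i≰j)) (last<b i))))

theorem5p11 : ExcludedMiddle 0ℓ →
    (A : ℕ → ℕ → Bool) (Φ : ℕ → List ℕ) →
    IsFolner Φ →
    ((n : ℕ) → DensityExists Φ (A n)) →
    LimsupPositive Φ A →
    Σ (ℕ → Set) λ B → Σ (ℕ → Set) λ C →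
      Infinite B × Infinite C ×
      ((b c : ℕ) → B b → C c → b < c → T (A b c))
theorem5p11 em A Φ folner _ limsup =
  (λ x → ∃[ k ] (b k ≡ x)) , (λ x → ∃[ k ] (c k ≡ x)) ,
  (λ n → b n , <⇒≤ (≤-<-trans (k≤last n) (last<b n)) , n , refl) ,
  (λ n → c n , ≤-trans (n≤1+n n) (k≤last (suc n)) , n , refl) ,
  λ { _ _ (i , refl) (j , refl) b<c → c∈A-b {i} {j} (b<c⇒≤ b<c) }
  where
  open Construction em A Φ folner
  open Chain (initial-stage limsup)
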